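{- (i) Every connected graph $G$ of order $n$ and minimum degree $\delta$ has a connected two-step dominating set $D$ with $|D| \leq \frac{3(n - |N^2(D)|)}{\delta + 1} - 2$. (ii) Every connected graph $G$ of order $n \geq 4$ and minimum degree $\delta$ has a connected two-way two-step dominating set $D'$ with $|D'| \leq \frac{3n}{\delta + 1} - 2$. Moreover, for every $\delta \geq 2$, there exist infinitely many connected graphs $G$ of minimum degree $\delta$, with order $n$, such that $\gamma^2_c(G) \geq \frac{3(n-2)}{\delta + 1} - 4$.
   Context: Graphs are finite and simple. For $S\subseteq V(G)$, $N^k(S)$ is the set of vertices at distance exactly $k$ from $S$. A set $D$ is a two-step dominating set if every vertex is at distance at most $2$ from $D$; it is connected if $G[D]$ is connected. $\gamma^2_c(G)$ is the minimum cardinality of a connected two-step dominating set of $G$. A connected two-step dominating set $D$ is a connected two-way two-step dominating set if (i) every pendant (degree-$1$) vertex of $G$ belongs to $D$, and (ii) every vertex of $N^2(D)$ has at least two neighbours in $N^1(D)$. -}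

module Defs where

open import Data.Nat using (ℕ; zero; suc; _+_; _*_; _∸_; _≤_)
open import Data.Bool using (Bool; true; false; _∧_; _∨_; not)
open import Data.Fin using (Fin; zero; suc)
open import Data.Fin.Subset using (Subset; _∈_; _∩_; ∣_∣)
open import Data.Vec using (tabulate; lookup)
open import Data.Product using (Σ; ∃; _×_)
open import Relation.Binary.PropositionalEquality using (_≡_)

record Graph (n : ℕ) : Set where
  field
    adj    : Fin n → Fin n → Bool
    sym    : ∀ u v → adj u v ≡ adj v u
    irrefl : ∀ v → adj v v ≡ false
open Graph public

anyFin : ∀ {n} → (Fin n → Bool) → Bool
anyFin {zero}  f = false
anyFin {suc n} f = f zero ∨ anyFin (λ i → f (suc i))

nbhd : ∀ {n} → Graph n → Fin n → Subset n
nbhd G v = tabulate (adj G v)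

deg : ∀ {n} → Graph n → Fin n → ℕ
deg G v = ∣ nbhd G v ∣

IsMinDegree : ∀ {n} → Graph n → ℕ → Set
IsMinDegree G δ = (∀ v → δ ≤ deg G v) × ∃ λ v → deg G v ≡ δ

-- within G S k v = true  iff  dist(v, S) ≤ k
within : ∀ {n} → Graph n → Subset n → ℕ → Fin n → Bool
within G S zero    v = lookup S v
within G S (suc k) v = within G S k v ∨ anyFin (λ u → within G S k u ∧ adj G u v)

N : ∀ {n} → Graph n → ℕ → Subset n → Subset n
N G zero    S = S
N G (suc k) S = tabulate (λ v → within G S (suc k) v ∧ not (within G S k v))

data Walk {n} (G : Graph n) (S : Subset n) : Fin n → Fin n → Set where
  here : ∀ {u} → u ∈ S → Walk G S u u
  step : ∀ {u v w} → u ∈ S → adj G u v ≡ true → Walk G S v w → Walk G S u w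

ConnectedIn : ∀ {n} → Graph n → Subset n → Set
ConnectedIn {n} G S = ∀ (u v : Fin n) → u ∈ S → v ∈ S → Walk G S u v

full : ∀ {n} → Subset n
full = tabulate (λ _ → true)

-- G is connected (and nonempty, since minimum degree is assumed to exist)
Connected : ∀ {n} → Graph n → Set
Connected G = ConnectedIn G full

TwoStepDominating : ∀ {n} → Graph n → Subset n → Set
TwoStepDominating G D = ∀ v → within G D 2 v ≡ true

ConnTwoStepDom : ∀ {n} → Graph n → Subset n → Set
ConnTwoStepDom G D = TwoStepDominating G D × ConnectedIn G D

ConnTwoWayTwoStepDom : ∀ {n} → Graph n → Subset n → Set
ConnTwoWayTwoStepDom G D =
  ConnTwoStepDom G D
  × (∀ v → deg G v ≡ 1 → v ∈ D)
  × (∀ v → v ∈ N G 2 D → 2 ≤ ∣ N G 1 D ∩ nbhd G v ∣)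

module Submission where

-- From a single vertex we
-- grow a connected set D keeping (|D| + 2)(δ + 1) ≤ 3|N[D]|: while a vertex u
-- is at distance ≥ 3 from D we add the three vertices where a walk to u leaves
-- the ball of radius 2, the last one bringing δ + 1 new vertices into N[D]
-- (`escape`); for (ii) with δ ≥ 2 we also add a vertex of N²(D) with at most one
-- neighbour in N¹(D) and that neighbour, gaining ≥ δ (`repair`).  D grows, so
-- this stops (`grow-until`); then |N[D]| + |N²(D)| ≤ n, and D = V when δ ≤ 1.
-- (iii): blow-ups of paths (module BlowUp) have a 1-Lipschitz level map, so a
-- connected two-step dominating set meets all but the extreme levels (module
-- Levelled); level sizes 1, δ, 1, (1, δ − 1, 1)ᵐ, 1, δ, 1 give the bound
-- (module Family).

open import Defs renaming (sym to adj-sym)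
open import Data.Nat using (ℕ; zero; suc; _+_; _*_; _∸_; _≤_; _<_; _≤?_; _<ᵇ_; _≤ᵇ_; ∣_-_∣; z≤n; s≤s; s≤s⁻¹)
open import Data.Nat.Properties hiding (_≟_)
open import Data.Nat.Induction using (<-wellFounded)
open import Data.Nat.ListAction using (sum)
open import Data.Nat.Solver using (module +-*-Solver)
open import Induction.WellFounded using (Acc; acc)
open import Data.Bool using (Bool; true; false; _∧_; _∨_; not; T; if_then_else_)
open import Data.Bool.Properties using (¬-not) renaming (_≟_ to _≟ᵇ_)
open import Data.Unit using (tt)
open import Data.Empty using (⊥-elim)
open import Data.Fin using (Fin; zero; suc; _↑ˡ_; _↑ʳ_; splitAt; _≟_)
open import Data.Fin.Properties using (splitAt-↑ˡ; splitAt-↑ʳ; all?; any?; ¬∀⟶∃¬)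
open import Data.Fin.Subset using (Subset; _∈_; _∉_; _⊆_; _∩_; _∪_; ⁅_⁆; ∣_∣; Empty)
open import Data.Fin.Subset.Properties
  using (x∈p∩q⁻; x∈p∩q⁺; x∈p∪q⁻; x∈p∪q⁺; p⊆p∪q; x∈⁅x⁆; x∈⁅y⁆⇒x≡y; ∣⁅x⁆∣≡1; Empty-unique; ∣⊥∣≡0;
         ∣p∣≤n; ∣p∩q∣≤∣p∣; p⊆q⇒∣p∣≤∣q∣; p⊂q⇒∣p∣<∣q∣; ⊆-antisym; _∈?_)
open import Data.List using (List; []; _∷_; length)
open import Data.List.Relation.Unary.All using (All; []; _∷_)
open import Data.Vec using ([]; _∷_; tabulate; lookup)
open import Data.Vec.Properties using (lookup∘tabulate; []=⇒lookup; lookup⇒[]=; tabulate-cong)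
open import Data.Product using (Σ; ∃-syntax; _×_; _,_; proj₁; proj₂)
open import Data.Sum using (_⊎_; inj₁; inj₂; [_,_]′)
open import Relation.Nullary using (yes; no; does; ¬?; _×-dec_)
open import Relation.Nullary.Decidable using (decidable-stable)
open import Relation.Binary.PropositionalEquality
  using (_≡_; _≢_; refl; sym; trans; cong; cong₂; subst; module ≡-Reasoning)

∨-introˡ : ∀ {a} b → a ≡ true → a ∨ b ≡ true
∨-introˡ b refl = refl

∨-introʳ : ∀ a {b} → b ≡ true → a ∨ b ≡ true
∨-introʳ true  _ = refl
∨-introʳ false e = e

∨-elim : ∀ a {b} → a ∨ b ≡ true → a ≡ true ⊎ b ≡ true
∨-elim true  _ = inj₁ refl
∨-elim false e = inj₂ e

∧-intro : ∀ {a b} → a ≡ true → b ≡ true → a ∧ b ≡ true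
∧-intro refl refl = refl

∧-elimˡ : ∀ a {b} → a ∧ b ≡ true → a ≡ true
∧-elimˡ true _ = refl

∧-elimʳ : ∀ a {b} → a ∧ b ≡ true → b ≡ true
∧-elimʳ true e = e

not-true : ∀ a → not a ≡ true → a ≡ false
not-true false _ = refl

not-false : ∀ {a} → a ≡ false → not a ≡ true
not-false refl = refl

true≢false : ∀ {a} {A : Set} → a ≡ true → a ≡ false → A
true≢false refl ()

T⇒≡true : ∀ b → T b → b ≡ true
T⇒≡true true _ = refl

≡true⇒T : ∀ {b} → b ≡ true → T b
≡true⇒T refl = tt

anyFin-intro : ∀ {n} (f : Fin n → Bool) i → f i ≡ true → anyFin f ≡ true
anyFin-intro f zero    e = ∨-introˡ _ e
anyFin-intro f (suc i) e = ∨-introʳ (f zero) (anyFin-intro (λ j → f (suc j)) i e)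

anyFin-elim : ∀ {n} (f : Fin n → Bool) → anyFin f ≡ true → ∃[ i ] f i ≡ true
anyFin-elim {suc n} f e with ∨-elim (f zero) e
... | inj₁ e₀ = zero , e₀
... | inj₂ eₛ with anyFin-elim (λ j → f (suc j)) eₛ
...   | i , eᵢ = suc i , eᵢ

lookup⇒∈ : ∀ {n} {S : Subset n} {x} → lookup S x ≡ true → x ∈ S
lookup⇒∈ {S = S} {x} = lookup⇒[]= x S

∈-tabulate⁺ : ∀ {n} (f : Fin n → Bool) {x} → f x ≡ true → x ∈ tabulate f
∈-tabulate⁺ f {x} e = lookup⇒∈ (trans (lookup∘tabulate f x) e)

∈-tabulate⁻ : ∀ {n} (f : Fin n → Bool) {x} → x ∈ tabulate f → f x ≡ true
∈-tabulate⁻ f {x} m = trans (sym (lookup∘tabulate f x)) ([]=⇒lookup m)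

∣p∪q∣+∣p∩q∣≡∣p∣+∣q∣ : ∀ {n} (p q : Subset n) → ∣ p ∪ q ∣ + ∣ p ∩ q ∣ ≡ ∣ p ∣ + ∣ q ∣
∣p∪q∣+∣p∩q∣≡∣p∣+∣q∣ []          []          = refl
∣p∪q∣+∣p∩q∣≡∣p∣+∣q∣ (true ∷ p)  (true ∷ q)  = begin
  suc (∣ p ∪ q ∣ + suc ∣ p ∩ q ∣)  ≡⟨ cong suc (+-suc ∣ p ∪ q ∣ _) ⟩
  suc (suc (∣ p ∪ q ∣ + ∣ p ∩ q ∣)) ≡⟨ cong (λ k → suc (suc k)) (∣p∪q∣+∣p∩q∣≡∣p∣+∣q∣ p q) ⟩
  suc (suc (∣ p ∣ + ∣ q ∣))        ≡⟨ cong suc (+-suc ∣ p ∣ ∣ q ∣) ⟨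
  suc (∣ p ∣ + suc ∣ q ∣)          ∎
  where open ≡-Reasoning
∣p∪q∣+∣p∩q∣≡∣p∣+∣q∣ (true ∷ p)  (false ∷ q) = cong suc (∣p∪q∣+∣p∩q∣≡∣p∣+∣q∣ p q)
∣p∪q∣+∣p∩q∣≡∣p∣+∣q∣ (false ∷ p) (true ∷ q)  = begin
  suc (∣ p ∪ q ∣ + ∣ p ∩ q ∣) ≡⟨ cong suc (∣p∪q∣+∣p∩q∣≡∣p∣+∣q∣ p q) ⟩
  suc (∣ p ∣ + ∣ q ∣)         ≡⟨ +-suc ∣ p ∣ ∣ q ∣ ⟨
  ∣ p ∣ + suc ∣ q ∣           ∎
  where open ≡-Reasoning
∣p∪q∣+∣p∩q∣≡∣p∣+∣q∣ (false ∷ p) (false ∷ q) = ∣p∪q∣+∣p∩q∣≡∣p∣+∣q∣ p q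

∣p∪q∣≤∣p∣+∣q∣ : ∀ {n} (p q : Subset n) → ∣ p ∪ q ∣ ≤ ∣ p ∣ + ∣ q ∣
∣p∪q∣≤∣p∣+∣q∣ p q = subst (∣ p ∪ q ∣ ≤_) (∣p∪q∣+∣p∩q∣≡∣p∣+∣q∣ p q) (m≤m+n _ _)

disjoint-∣p∩q∣≡0 : ∀ {n} (p q : Subset n) → (∀ {x} → x ∈ p → x ∉ q) → ∣ p ∩ q ∣ ≡ 0
disjoint-∣p∩q∣≡0 {n} p q disjoint = trans (cong ∣_∣ (Empty-unique empty)) (∣⊥∣≡0 n)
  where
  empty : Empty (p ∩ q)
  empty (x , x∈p∩q) = let (x∈p , x∈q) = x∈p∩q⁻ p q x∈p∩q in disjoint x∈p x∈q

disjoint-∣p∪q∣ : ∀ {n} (p q : Subset n) → (∀ {x} → x ∈ p → x ∉ q) → ∣ p ∪ q ∣ ≡ ∣ p ∣ + ∣ q ∣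
disjoint-∣p∪q∣ p q disjoint = begin
  ∣ p ∪ q ∣                 ≡⟨ +-identityʳ _ ⟨
  ∣ p ∪ q ∣ + 0             ≡⟨ cong (∣ p ∪ q ∣ +_) (disjoint-∣p∩q∣≡0 p q disjoint) ⟨
  ∣ p ∪ q ∣ + ∣ p ∩ q ∣     ≡⟨ ∣p∪q∣+∣p∩q∣≡∣p∣+∣q∣ p q ⟩
  ∣ p ∣ + ∣ q ∣             ∎
  where open ≡-Reasoning

∣p∪⁅x⁆∣≤1+∣p∣ : ∀ {n} (p : Subset n) x → ∣ p ∪ ⁅ x ⁆ ∣ ≤ suc ∣ p ∣
∣p∪⁅x⁆∣≤1+∣p∣ p x = begin
  ∣ p ∪ ⁅ x ⁆ ∣       ≤⟨ ∣p∪q∣≤∣p∣+∣q∣ p ⁅ x ⁆ ⟩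
  ∣ p ∣ + ∣ ⁅ x ⁆ ∣   ≡⟨ cong (∣ p ∣ +_) (∣⁅x⁆∣≡1 x) ⟩
  ∣ p ∣ + 1           ≡⟨ +-comm ∣ p ∣ 1 ⟩
  suc ∣ p ∣           ∎
  where open ≤-Reasoning

module WalkFacts {n} (G : Graph n) where

  walk-start : ∀ {S u v} → Walk G S u v → u ∈ S
  walk-start (here u∈S)     = u∈S
  walk-start (step u∈S _ _) = u∈S

  _++ʷ_ : ∀ {S u v w} → Walk G S u v → Walk G S v w → Walk G S u w
  here _         ++ʷ q = q
  step u∈S uv p  ++ʷ q = step u∈S uv (p ++ʷ q)

  reverse : ∀ {S u v} → Walk G S u v → Walk G S v u
  reverse (here u∈S) = here u∈S
  reverse {u = u} (step {v = v} u∈S uv p) =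
    reverse p ++ʷ step (walk-start p) (trans (adj-sym G v u) uv) (here u∈S)

  walk-mono : ∀ {S T u v} → S ⊆ T → Walk G S u v → Walk G T u v
  walk-mono S⊆T (here u∈S)     = here (S⊆T u∈S)
  walk-mono S⊆T (step u∈S uv p) = step (S⊆T u∈S) uv (walk-mono S⊆T p)

  hub-connected : ∀ {S} h → (∀ v → v ∈ S → Walk G S h v) → ConnectedIn G S
  hub-connected h reach u v u∈S v∈S = reverse (reach u u∈S) ++ʷ reach v v∈S

  exit-edge : ∀ {S a b} (f : Fin n → Bool) → Walk G S a b → f a ≡ true → f b ≡ false →
              ∃[ p ] ∃[ q ] f p ≡ true × adj G p q ≡ true × f q ≡ false
  exit-edge f (here _) fa fb = true≢false fa fb
  exit-edge f (step {u = a} {v = v} _ av p) fa fb with f v in fv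
  ... | false = a , v , fa , av , fv
  ... | true  = exit-edge f p fv fb

∈full : ∀ {n} {v : Fin n} → v ∈ full
∈full = ∈-tabulate⁺ (λ _ → true) refl

-- The closed ball of radius k around S (so Ball G D 1 is N[D]), and the
-- closed neighbourhood N[v] of a vertex.
Ball : ∀ {n} → Graph n → Subset n → ℕ → Subset n
Ball G S k = tabulate (within G S k)

closedNbhd : ∀ {n} → Graph n → Fin n → Subset n
closedNbhd G v = ⁅ v ⁆ ∪ nbhd G v

module Distance {n} (G : Graph n) where

  open WalkFacts G

  ∈Ball⁺ : ∀ S k {v} → within G S k v ≡ true → v ∈ Ball G S k
  ∈Ball⁺ S k = ∈-tabulate⁺ (within G S k)

  ∈Ball⁻ : ∀ S k {v} → v ∈ Ball G S k → within G S k v ≡ true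
  ∈Ball⁻ S k = ∈-tabulate⁻ (within G S k)

  ∈layer⁺ : ∀ S k {v} → within G S (suc k) v ≡ true → within G S k v ≡ false → v ∈ N G (suc k) S
  ∈layer⁺ S k near far =
    ∈-tabulate⁺ (λ u → within G S (suc k) u ∧ not (within G S k u)) (∧-intro near (not-false far))

  ∈layer⁻ : ∀ S k {v} → v ∈ N G (suc k) S → within G S (suc k) v ≡ true × within G S k v ≡ false
  ∈layer⁻ S k {v} v∈N = ∧-elimˡ _ v-layer , not-true _ (∧-elimʳ (within G S (suc k) v) v-layer)
    where v-layer = ∈-tabulate⁻ (λ u → within G S (suc k) u ∧ not (within G S k u)) v∈N

  within-member : ∀ S k {v} → v ∈ S → within G S k v ≡ true
  within-member S zero    v∈S = []=⇒lookup v∈S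
  within-member S (suc k) v∈S = ∨-introˡ _ (within-member S k v∈S)

  within-suc : ∀ S k {v} → within G S k v ≡ true → within G S (suc k) v ≡ true
  within-suc S k = ∨-introˡ _

  within-step : ∀ S k {u v} → within G S k u ≡ true → adj G u v ≡ true →
                within G S (suc k) v ≡ true
  within-step S k {u} {v} wu uv =
    ∨-introʳ (within G S k v) (anyFin-intro _ u (∧-intro wu uv))

  within-suc⁻ : ∀ S k {v} → within G S (suc k) v ≡ true →
                within G S k v ≡ true ⊎ ∃[ u ] within G S k u ≡ true × adj G u v ≡ true
  within-suc⁻ S k {v} e with ∨-elim (within G S k v) e
  ... | inj₁ wv = inj₁ wv
  ... | inj₂ any with anyFin-elim _ any
  ...   | u , wu∧uv = inj₂ (u , ∧-elimˡ _ wu∧uv , ∧-elimʳ (within G S k u) wu∧uv)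

  predecessor : ∀ S k {v} → within G S (suc k) v ≡ true → within G S k v ≡ false →
                ∃[ u ] within G S k u ≡ true × adj G u v ≡ true
  predecessor S k w w' with within-suc⁻ S k w
  ... | inj₁ wv = true≢false wv w'
  ... | inj₂ u  = u

  before-far : ∀ S k {p q} → adj G p q ≡ true → within G S (suc k) q ≡ false → within G S k p ≡ false
  before-far S k {p} pq q-far with within G S k p in e
  ... | false = refl
  ... | true  = true≢false (within-step S k e pq) q-far

  within-mono : ∀ {S T} → S ⊆ T → ∀ k {v} → within G S k v ≡ true → within G T k v ≡ true
  within-mono S⊆T zero    e = []=⇒lookup (S⊆T (lookup⇒∈ e))
  within-mono {S} {T} S⊆T (suc k) e with within-suc⁻ S k e
  ... | inj₁ wv            = within-suc T k (within-mono S⊆T k wv)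
  ... | inj₂ (u , wu , uv) = within-step T k (within-mono S⊆T k wu) uv

  x∈D∪⁅x⁆ : ∀ {D : Subset n} x → x ∈ D ∪ ⁅ x ⁆
  x∈D∪⁅x⁆ x = x∈p∪q⁺ (inj₂ (x∈⁅x⁆ x))

  next-to-new : ∀ D x {y} → adj G x y ≡ true → within G (D ∪ ⁅ x ⁆) 1 y ≡ true
  next-to-new D x xy = within-step (D ∪ ⁅ x ⁆) 0 (within-member (D ∪ ⁅ x ⁆) 0 (x∈D∪⁅x⁆ x)) xy

  attach : ∀ {D x} → ConnectedIn G D → within G D 1 x ≡ true → ConnectedIn G (D ∪ ⁅ x ⁆)
  attach {D} {x} conn x-near = hub-connected (proj₁ anchor) reach
    where
    anchor : ∃[ y ] y ∈ D × Walk G (D ∪ ⁅ x ⁆) y x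
    anchor with within-suc⁻ D 0 x-near
    ... | inj₁ x∈D            = x , lookup⇒∈ x∈D , here (x∈D∪⁅x⁆ x)
    ... | inj₂ (y , y∈D , yx) = y , lookup⇒∈ y∈D , step (p⊆p∪q _ (lookup⇒∈ y∈D)) yx (here (x∈D∪⁅x⁆ x))
    reach : ∀ v → v ∈ D ∪ ⁅ x ⁆ → Walk G (D ∪ ⁅ x ⁆) (proj₁ anchor) v
    reach v v∈ with x∈p∪q⁻ D ⁅ x ⁆ v∈
    ... | inj₁ v∈D = walk-mono (p⊆p∪q _) (conn _ v (proj₁ (proj₂ anchor)) v∈D)
    ... | inj₂ v∈x = subst (Walk G _ _) (sym (x∈⁅y⁆⇒x≡y x v∈x)) (proj₂ (proj₂ anchor))

  -- N[v] is the disjoint union of {v} and N(v), since G has no loops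
  ∣closedNbhd∣ : ∀ v → ∣ closedNbhd G v ∣ ≡ suc (deg G v)
  ∣closedNbhd∣ v = trans (disjoint-∣p∪q∣ ⁅ v ⁆ (nbhd G v) v∉N⟨v⟩)
                         (cong (_+ deg G v) (∣⁅x⁆∣≡1 v))
    where
    v∉N⟨v⟩ : ∀ {x} → x ∈ ⁅ v ⁆ → x ∉ nbhd G v
    v∉N⟨v⟩ {x} x∈v x∈N with x∈⁅y⁆⇒x≡y v x∈v
    ... | refl = true≢false (∈-tabulate⁻ (adj G x) x∈N) (irrefl G x)

  closedNbhd⊆Ball : ∀ {D v} → v ∈ D → closedNbhd G v ⊆ Ball G D 1
  closedNbhd⊆Ball {D} {v} v∈D {u} u∈N[v] with x∈p∪q⁻ ⁅ v ⁆ (nbhd G v) u∈N[v]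
  ... | inj₁ u∈v rewrite x∈⁅y⁆⇒x≡y v u∈v = ∈Ball⁺ D 1 (within-member D 1 v∈D)
  ... | inj₂ u∈N = ∈Ball⁺ D 1 (within-step D 0 (within-member D 0 v∈D) (∈-tabulate⁻ (adj G v) u∈N))

  ball-gain : ∀ {D D' t} → D ⊆ D' → t ∈ D' →
              ∣ Ball G D 1 ∣ + ∣ closedNbhd G t ∣ ≤ ∣ Ball G D' 1 ∣ + ∣ Ball G D 1 ∩ closedNbhd G t ∣
  ball-gain {D} {D'} {t} D⊆D' t∈D' = begin
    ∣ B ∣ + ∣ N[t] ∣             ≡⟨ ∣p∪q∣+∣p∩q∣≡∣p∣+∣q∣ B N[t] ⟨
    ∣ B ∪ N[t] ∣ + ∣ B ∩ N[t] ∣  ≤⟨ +-monoˡ-≤ _ (p⊆q⇒∣p∣≤∣q∣ B∪N[t]⊆B') ⟩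
    ∣ Ball G D' 1 ∣ + ∣ B ∩ N[t] ∣ ∎
    where
    open ≤-Reasoning
    B = Ball G D 1
    N[t] = closedNbhd G t
    B∪N[t]⊆B' : B ∪ N[t] ⊆ Ball G D' 1
    B∪N[t]⊆B' x∈ with x∈p∪q⁻ B N[t] x∈
    ... | inj₁ x∈B = ∈Ball⁺ D' 1 (within-mono D⊆D' 1 (∈Ball⁻ D 1 x∈B))
    ... | inj₂ x∈N = closedNbhd⊆Ball t∈D' x∈N

  far-disjoint : ∀ {D q} → within G D 2 q ≡ false →
                 ∀ {y} → y ∈ Ball G D 1 → y ∉ closedNbhd G q
  far-disjoint {D} {q} q-far {y} y∈B y∈N[q] with x∈p∪q⁻ ⁅ q ⁆ (nbhd G q) y∈N[q]
  ... | inj₁ y∈q rewrite x∈⁅y⁆⇒x≡y q y∈q = true≢false (within-suc D 1 (∈Ball⁻ D 1 y∈B)) q-far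
  ... | inj₂ y∈N = true≢false
    (within-step D 1 (∈Ball⁻ D 1 y∈B) (trans (adj-sym G y q) (∈-tabulate⁻ (adj G q) y∈N))) q-far

  frontier-overlap : ∀ {D w} → within G D 1 w ≡ false →
                     Ball G D 1 ∩ closedNbhd G w ⊆ N G 1 D ∩ nbhd G w
  frontier-overlap {D} {w} w-far {y} y∈ with x∈p∩q⁻ (Ball G D 1) (closedNbhd G w) y∈
  ... | y∈B , y∈N[w] with x∈p∪q⁻ ⁅ w ⁆ (nbhd G w) y∈N[w]
  ...   | inj₁ y∈w rewrite x∈⁅y⁆⇒x≡y w y∈w = true≢false (∈Ball⁻ D 1 y∈B) w-far
  ...   | inj₂ y∈N = x∈p∩q⁺ (∈layer⁺ D 0 (∈Ball⁻ D 1 y∈B) y∉D , y∈N)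
    where
    y∉D : lookup D y ≡ false
    y∉D with lookup D y in e
    ... | false = refl
    ... | true  = true≢false
      (within-step D 0 e (trans (adj-sym G y w) (∈-tabulate⁻ (adj G w) y∈N))) w-far

  ball-and-layer : ∀ D → ∣ Ball G D 1 ∣ + ∣ N G 2 D ∣ ≤ n
  ball-and-layer D =
    subst (_≤ n) (disjoint-∣p∪q∣ (Ball G D 1) (N G 2 D) disjoint) (∣p∣≤n (Ball G D 1 ∪ N G 2 D))
    where
    disjoint : ∀ {x} → x ∈ Ball G D 1 → x ∉ N G 2 D
    disjoint x∈B x∈N² = true≢false (∈Ball⁻ D 1 x∈B) (proj₂ (∈layer⁻ D 1 x∈N²))

grow-until : ∀ {n} (Inv Done : Subset n → Set) →
             (∀ D → Inv D → Done D ⊎ ∃[ D' ] Inv D' × ∣ D ∣ < ∣ D' ∣) →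
             ∀ D → Inv D → ∃[ D' ] Inv D' × Done D'
grow-until {n} Inv Done advance D₀ inv₀ = go D₀ inv₀ (<-wellFounded (n ∸ ∣ D₀ ∣))
  where
  go : ∀ D → Inv D → Acc _<_ (n ∸ ∣ D ∣) → ∃[ D' ] Inv D' × Done D'
  go D inv (acc rs) with advance D inv
  ... | inj₁ done                 = D , inv , done
  ... | inj₂ (D' , inv' , larger) = go D' inv' (rs (∸-monoʳ-< larger (∣p∣≤n D')))

-- The arithmetic of one greedy step: a set of size a with closed neighbourhood
-- of size b grows by at most c vertices while its closed neighbourhood gains e
-- vertices up to an overlap o.
invariant-step : ∀ a a' b b' c o e → a' ≤ c + a → (a + 2) * e ≤ 3 * b → b + e ≤ b' + o →
                 c * e + 3 * o ≤ 3 * e → (a' + 2) * e ≤ 3 * b'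
invariant-step a a' b b' c o e a'≤c+a bound gain budget = +-cancelʳ-≤ (3 * o) _ _ (begin
  (a' + 2) * e + 3 * o            ≤⟨ +-monoˡ-≤ (3 * o) (*-monoˡ-≤ e (+-monoˡ-≤ 2 a'≤c+a)) ⟩
  (c + a + 2) * e + 3 * o         ≡⟨ solve 4 (λ a c o e → (c :+ a :+ con 2) :* e :+ con 3 :* o
                                              := (a :+ con 2) :* e :+ (c :* e :+ con 3 :* o))
                                            refl a c o e ⟩
  (a + 2) * e + (c * e + 3 * o)   ≤⟨ +-mono-≤ bound budget ⟩
  3 * b + 3 * e                   ≡⟨ *-distribˡ-+ 3 b e ⟨
  3 * (b + e)                     ≤⟨ *-monoʳ-≤ 3 gain ⟩
  3 * (b' + o)                    ≡⟨ *-distribˡ-+ 3 b' o ⟩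
  3 * b' + 3 * o                  ∎)
  where
  open ≤-Reasoning
  open +-*-Solver

-- The budget of the repair step: two new vertices against a gain of δ.
repair-budget : ∀ δ → 2 ≤ δ → 2 * (δ + 1) + 3 * 1 ≤ 3 * (δ + 1)
repair-budget δ 2≤δ = begin
  2 * (δ + 1) + 3 * 1   ≡⟨ solve 1 (λ δ → con 2 :* (δ :+ con 1) :+ con 3 :* con 1
                                      := con 2 :* δ :+ con 2 :+ con 3) refl δ ⟩
  2 * δ + 2 + 3         ≤⟨ +-monoˡ-≤ 3 (+-monoʳ-≤ (2 * δ) 2≤δ) ⟩
  2 * δ + δ + 3         ≡⟨ solve 1 (λ δ → con 2 :* δ :+ δ :+ con 3 := con 3 :* (δ :+ con 1)) refl δ ⟩
  3 * (δ + 1)           ∎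
  where
  open ≤-Reasoning
  open +-*-Solver

module Greedy {n} (G : Graph n) (δ : ℕ) (connected : Connected G)
              (min-deg : ∀ v → δ ≤ deg G v) where

  open WalkFacts G
  open Distance G

  record Invariant (D : Subset n) : Set where
    field
      conn   : ConnectedIn G D
      member : ∃[ h ] h ∈ D
      bound  : (∣ D ∣ + 2) * (δ + 1) ≤ 3 * ∣ Ball G D 1 ∣

  Enlargeable : Subset n → Set
  Enlargeable D = ∃[ D' ] Invariant D' × ∣ D ∣ < ∣ D' ∣

  closedNbhd-large : ∀ v → δ + 1 ≤ ∣ closedNbhd G v ∣
  closedNbhd-large v = subst (δ + 1 ≤_) (sym (∣closedNbhd∣ v))
                             (subst (_≤ suc (deg G v)) (+-comm 1 δ) (s≤s (min-deg v)))

  start : ∀ v → Invariant ⁅ v ⁆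
  start v = record { conn = conn ; member = v , x∈⁅x⁆ v ; bound = bound }
    where
    conn : ConnectedIn G ⁅ v ⁆
    conn = hub-connected v λ u u∈v → subst (Walk G ⁅ v ⁆ v) (sym (x∈⁅y⁆⇒x≡y v u∈v)) (here (x∈⁅x⁆ v))
    bound : (∣ ⁅ v ⁆ ∣ + 2) * (δ + 1) ≤ 3 * ∣ Ball G ⁅ v ⁆ 1 ∣
    bound rewrite ∣⁅x⁆∣≡1 v =
      *-monoʳ-≤ 3 (≤-trans (closedNbhd-large v) (p⊆q⇒∣p∣≤∣q∣ (closedNbhd⊆Ball (x∈⁅x⁆ v))))

  extend : ∀ {D D' t} c o → Invariant D → ConnectedIn G D' → D ⊆ D' → t ∈ D' → t ∉ D →
           ∣ D' ∣ ≤ c + ∣ D ∣ → ∣ Ball G D 1 ∩ closedNbhd G t ∣ ≤ o →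
           c * (δ + 1) + 3 * o ≤ 3 * (δ + 1) → Enlargeable D
  extend {D} {D'} {t} c o inv conn' D⊆D' t∈D' t∉D size shared budget =
    D' , record { conn = conn' ; member = t , t∈D' ; bound = bound' } ,
    p⊂q⇒∣p∣<∣q∣ (D⊆D' , t , t∈D' , t∉D)
    where
    gain : ∣ Ball G D 1 ∣ + (δ + 1) ≤ ∣ Ball G D' 1 ∣ + o
    gain = ≤-trans (+-monoʳ-≤ _ (closedNbhd-large t))
                   (≤-trans (ball-gain D⊆D' t∈D') (+-monoʳ-≤ _ shared))
    bound' : (∣ D' ∣ + 2) * (δ + 1) ≤ 3 * ∣ Ball G D' 1 ∣
    bound' = invariant-step (∣ D ∣) (∣ D' ∣) (∣ Ball G D 1 ∣) (∣ Ball G D' 1 ∣) c o (δ + 1)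
                            size (Invariant.bound inv) gain budget

  -- Step (i): if u is at distance at least 3 from D, a walk from D to u leaves
  -- the ball of radius 2 along an edge p q, where p is at distance exactly 2;
  -- adding q, p and a neighbour x ∈ N[D] of p enlarges N[D] by all of N[q].
  escape : ∀ {D u} → Invariant D → within G D 2 u ≡ false → Enlargeable D
  escape {D} {u} inv u-far with Invariant.member inv
  ... | h , h∈D with exit-edge (within G D 2) (connected h u ∈full ∈full) (within-member D 2 h∈D) u-far
  ...   | p , q , p-near , pq , q-far with predecessor D 1 p-near (before-far D 1 pq q-far)
  ...     | x , x-near , xp =
    extend 3 0 inv conn' D⊆D₃ (x∈D∪⁅x⁆ q) q∉D size shared (≤-reflexive (+-identityʳ _))
    where
    D₁ = D ∪ ⁅ x ⁆
    D₂ = D₁ ∪ ⁅ p ⁆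
    D₃ = D₂ ∪ ⁅ q ⁆
    conn' : ConnectedIn G D₃
    conn' = attach (attach (attach (Invariant.conn inv) x-near) (next-to-new D x xp))
                   (next-to-new D₁ p pq)
    D⊆D₃ : D ⊆ D₃
    D⊆D₃ v∈D = p⊆p∪q _ (p⊆p∪q _ (p⊆p∪q _ v∈D))
    q∉D : q ∉ D
    q∉D q∈D = true≢false (within-member D 2 q∈D) q-far
    size : ∣ D₃ ∣ ≤ 3 + ∣ D ∣
    size = ≤-trans (∣p∪⁅x⁆∣≤1+∣p∣ D₂ q)
             (s≤s (≤-trans (∣p∪⁅x⁆∣≤1+∣p∣ D₁ p) (s≤s (∣p∪⁅x⁆∣≤1+∣p∣ D x))))
    shared : ∣ Ball G D 1 ∩ closedNbhd G q ∣ ≤ 0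
    shared = ≤-reflexive (disjoint-∣p∩q∣≡0 _ _ (far-disjoint {D} q-far))

  -- Step (ii), for δ ≥ 2: a vertex w ∈ N²(D) with at most one neighbour in
  -- N¹(D) is added together with a neighbour x ∈ N¹(D); N[w] meets N[D] in at
  -- most that one vertex.
  repair : ∀ {D w} → 2 ≤ δ → Invariant D → w ∈ N G 2 D → ∣ N G 1 D ∩ nbhd G w ∣ ≤ 1 →
           Enlargeable D
  repair {D} {w} 2≤δ inv w∈N² few with ∈layer⁻ D 1 w∈N²
  ... | w-near , w-far with predecessor D 1 w-near w-far
  ...   | x , x-near , xw =
    extend 2 1 inv conn' D⊆D₂ (x∈D∪⁅x⁆ w) w∉D size shared (repair-budget δ 2≤δ)
    where
    D₁ = D ∪ ⁅ x ⁆
    D₂ = D₁ ∪ ⁅ w ⁆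
    conn' : ConnectedIn G D₂
    conn' = attach (attach (Invariant.conn inv) x-near) (next-to-new D x xw)
    D⊆D₂ : D ⊆ D₂
    D⊆D₂ v∈D = p⊆p∪q _ (p⊆p∪q _ v∈D)
    w∉D : w ∉ D
    w∉D w∈D = true≢false (within-member D 1 w∈D) w-far
    size : ∣ D₂ ∣ ≤ 2 + ∣ D ∣
    size = ≤-trans (∣p∪⁅x⁆∣≤1+∣p∣ D₁ w) (s≤s (∣p∪⁅x⁆∣≤1+∣p∣ D x))
    shared : ∣ Ball G D 1 ∩ closedNbhd G w ∣ ≤ 1
    shared = ≤-trans (p⊆q⇒∣p∣≤∣q∣ (frontier-overlap {D} w-far)) few

  dominate-step : ∀ D → Invariant D → TwoStepDominating G D ⊎ Enlargeable D
  dominate-step D inv with all? (λ v → within G D 2 v ≟ᵇ true)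
  ... | yes dominating = inj₁ dominating
  ... | no ¬dominating =
    let (u , u-far) = ¬∀⟶∃¬ n _ (λ v → within G D 2 v ≟ᵇ true) ¬dominating
    in inj₂ (escape inv (¬-not u-far))

  TwoWay : Subset n → Set
  TwoWay D = ∀ v → v ∈ N G 2 D → 2 ≤ ∣ N G 1 D ∩ nbhd G v ∣

  two-way-step : 2 ≤ δ → ∀ D → Invariant D → (TwoStepDominating G D × TwoWay D) ⊎ Enlargeable D
  two-way-step 2≤δ D inv with dominate-step D inv
  ... | inj₂ larger    = inj₂ larger
  ... | inj₁ dominating with any? (λ v → (v ∈? N G 2 D) ×-dec ¬? (2 ≤? ∣ N G 1 D ∩ nbhd G v ∣))
  ...   | yes (w , w∈N² , few) = inj₂ (repair 2≤δ inv w∈N² (≤-pred (≰⇒> few)))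
  ...   | no none = inj₁ (dominating , λ v v∈N² →
          decidable-stable (2 ≤? ∣ N G 1 D ∩ nbhd G v ∣) λ few → none (v , v∈N² , few))

∣full∣≡n : ∀ n → ∣ full {n} ∣ ≡ n
∣full∣≡n zero    = refl
∣full∣≡n (suc n) = cong suc (∣full∣≡n n)

-- In a connected graph the whole vertex set is trivially a connected two-way
-- two-step dominating set: it contains every vertex and N²(V) is empty.
whole-graph : ∀ {n} (G : Graph n) → Connected G → ConnTwoWayTwoStepDom G full
whole-graph G conn = ((λ v → within-member full 2 ∈full) , conn) , (λ v _ → ∈full) , no-layer
  where
  open Distance G
  no-layer : ∀ v → v ∈ N G 2 full → 2 ≤ ∣ N G 1 full ∩ nbhd G v ∣
  no-layer v v∈N² = true≢false (within-member full 1 ∈full) (proj₂ (∈layer⁻ full 1 v∈N²))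

small-degree-bound : ∀ n δ → 4 ≤ n → δ ≤ 1 → (n + 2) * (δ + 1) ≤ 3 * n
small-degree-bound n δ 4≤n δ≤1 = begin
  (n + 2) * (δ + 1) ≤⟨ *-monoʳ-≤ (n + 2) (+-monoˡ-≤ 1 δ≤1) ⟩
  (n + 2) * 2       ≡⟨ solve 1 (λ n → (n :+ con 2) :* con 2 := n :+ n :+ con 4) refl n ⟩
  n + n + 4         ≤⟨ +-monoʳ-≤ (n + n) 4≤n ⟩
  n + n + n         ≡⟨ solve 1 (λ n → n :+ n :+ n := con 3 :* n) refl n ⟩
  3 * n             ∎
  where
  open ≤-Reasoning
  open +-*-Solver

connected-two-step-domination :
  (n : ℕ) (G : Graph n) (δ : ℕ) → Connected G → IsMinDegree G δ →
  Σ (Subset n) λ D → ConnTwoStepDom G D × (∣ D ∣ + 2) * (δ + 1) ≤ 3 * (n ∸ ∣ N G 2 D ∣)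
connected-two-step-domination n G δ conn (min-deg , v , _) =
  D , (dominating , Invariant.conn inv) ,
  ≤-trans (Invariant.bound inv) (*-monoʳ-≤ 3 (m+n≤o⇒m≤o∸n (∣ Ball G D 1 ∣) (ball-and-layer D)))
  where
  open Greedy G δ conn min-deg
  open Distance G
  grown : ∃[ D ] Invariant D × TwoStepDominating G D
  grown = grow-until Invariant (TwoStepDominating G) dominate-step ⁅ v ⁆ (start v)
  D : Subset n
  D = proj₁ grown
  inv : Invariant D
  inv = proj₁ (proj₂ grown)
  dominating : TwoStepDominating G D
  dominating = proj₂ (proj₂ grown)

connected-two-way-two-step-domination :
  (n : ℕ) (G : Graph n) (δ : ℕ) → 4 ≤ n → Connected G → IsMinDegree G δ →
  Σ (Subset n) λ D → ConnTwoWayTwoStepDom G D × (∣ D ∣ + 2) * (δ + 1) ≤ 3 * n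
connected-two-way-two-step-domination n G δ 4≤n conn (min-deg , v , _) with 2 ≤? δ
... | no δ≱2 = full , whole-graph G conn ,
  subst (λ k → (k + 2) * (δ + 1) ≤ 3 * n) (sym (∣full∣≡n n))
        (small-degree-bound n δ 4≤n (≤-pred (≰⇒> δ≱2)))
... | yes 2≤δ = D , ((dominating , Invariant.conn inv) , no-pendant , two-way) ,
  ≤-trans (Invariant.bound inv) (*-monoʳ-≤ 3 {∣ Ball G D 1 ∣} (∣p∣≤n (Ball G D 1)))
  where
  open Greedy G δ conn min-deg
  grown : ∃[ D ] Invariant D × (TwoStepDominating G D × TwoWay D)
  grown = grow-until Invariant _ (two-way-step 2≤δ) ⁅ v ⁆ (start v)
  D : Subset n
  D = proj₁ grown
  inv : Invariant D
  inv = proj₁ (proj₂ grown)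
  dominating : TwoStepDominating G D
  dominating = proj₁ (proj₂ (proj₂ grown))
  two-way : TwoWay D
  two-way = proj₂ (proj₂ (proj₂ grown))
  -- with δ ≥ 2 there are no pendant vertices
  no-pendant : ∀ u → deg G u ≡ 1 → u ∈ D
  no-pendant u deg≡1 = ⊥-elim (≤⇒≯ (subst (δ ≤_) deg≡1 (min-deg u)) 2≤δ)

-- Such a map bounds connected two-step dominating
-- sets from below: they must meet every level except those near the ends.
module Levelled {n} (G : Graph n) (lv : Fin n → ℕ)
                (lipschitz : ∀ u v → adj G u v ≡ true → lv v ≤ suc (lv u)) where

  open Distance G

  -- discrete intermediate value theorem: a walk meets every level in between
  walk-visits : ∀ {S a b} → Walk G S a b → ∀ ℓ → lv a ≤ ℓ → ℓ ≤ lv b → ∃[ x ] x ∈ S × lv x ≡ ℓ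
  walk-visits {a = a} (here a∈S) ℓ a≤ℓ ℓ≤a = a , a∈S , ≤-antisym a≤ℓ ℓ≤a
  walk-visits {a = a} (step {v = v} a∈S av p) ℓ a≤ℓ ℓ≤b with ℓ ≤? lv a
  ... | yes ℓ≤a = a , a∈S , ≤-antisym a≤ℓ ℓ≤a
  ... | no  ℓ≰a = walk-visits p ℓ (≤-trans (lipschitz a v av) (≰⇒> ℓ≰a)) ℓ≤b

  within-levels : ∀ S k v → within G S k v ≡ true →
                  ∃[ w ] w ∈ S × lv w ≤ k + lv v × lv v ≤ k + lv w
  within-levels S zero v e = v , lookup⇒∈ e , ≤-refl , ≤-refl
  within-levels S (suc k) v e with within-suc⁻ S k e
  ... | inj₁ ev with within-levels S k v ev
  ...   | w , w∈S , w≤ , v≤ = w , w∈S , m≤n⇒m≤1+n w≤ , m≤n⇒m≤1+n v≤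
  within-levels S (suc k) v e | inj₂ (u , eu , uv) with within-levels S k u eu
  ... | w , w∈S , w≤ , u≤ = w , w∈S ,
        ≤-trans w≤ (≤-trans (+-monoʳ-≤ k (lipschitz v u (trans (adj-sym G v u) uv)))
                            (≤-reflexive (+-suc k (lv v)))) ,
        ≤-trans (lipschitz u v uv) (s≤s u≤)

  levels-met : ∀ D a k → (∀ j → j < k → ∃[ v ] v ∈ D × lv v ≡ a + j) → k ≤ ∣ D ∣
  levels-met D a k meets = ≤-trans (counted k ≤-refl) (∣p∩q∣≤∣p∣ D _)
    where
    low : ℕ → Fin n → Bool
    low j v = lv v <ᵇ a + j
    below : ℕ → Subset n
    below j = D ∩ tabulate (low j)
    below-⊆ : ∀ j → below j ⊆ below (suc j)
    below-⊆ j {x} x∈ with x∈p∩q⁻ D (tabulate (low j)) x∈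
    ... | x∈D , x-low = x∈p∩q⁺ (x∈D , ∈-tabulate⁺ (low (suc j)) (T⇒≡true _ (<⇒<ᵇ
      (≤-trans (<ᵇ⇒< _ _ (≡true⇒T (∈-tabulate⁻ (low j) x-low))) (+-monoʳ-≤ a (n≤1+n j))))))
    counted : ∀ j → j ≤ k → j ≤ ∣ below j ∣
    counted zero    _   = z≤n
    counted (suc j) j<k with meets j j<k
    ... | v , v∈D , v-level = ≤-trans (s≤s (counted j (<⇒≤ j<k)))
          (p⊂q⇒∣p∣<∣q∣ (below-⊆ j , v , x∈p∩q⁺ (v∈D , v-low) , v-not-low))
      where
      v-low : v ∈ tabulate (low (suc j))
      v-low = ∈-tabulate⁺ (low (suc j)) (T⇒≡true _ (<⇒<ᵇ
                (subst (_< a + suc j) (sym v-level) (+-monoʳ-< a (n<1+n j)))))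
      v-not-low : v ∉ below j
      v-not-low v∈ = <-irrefl v-level
        (<ᵇ⇒< (lv v) (a + j) (≡true⇒T (∈-tabulate⁻ (low j) (proj₂ (x∈p∩q⁻ D _ v∈)))))

  -- A connected two-step dominating set of a graph with vertices at levels 0
  -- and k + 3 has at least k members: it meets each level 2, …, k + 1.
  spanning-lower-bound : ∀ {D} k a b → lv a ≡ 0 → lv b ≡ 3 + k → ConnTwoStepDom G D →
                         k ≤ ∣ D ∣
  spanning-lower-bound {D} k a b a-bottom b-top (dominating , conn)
    with within-levels D 2 a (dominating a) | within-levels D 2 b (dominating b)
  ... | w₁ , w₁∈D , w₁≤2+a , _ | w₂ , w₂∈D , _ , b≤2+w₂ = levels-met D 2 k meets
    where
    w₁-low : lv w₁ ≤ 2
    w₁-low = subst (λ ℓ → lv w₁ ≤ 2 + ℓ) a-bottom w₁≤2+a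
    w₂-high : suc k ≤ lv w₂
    w₂-high = s≤s⁻¹ (s≤s⁻¹ (subst (_≤ 2 + lv w₂) b-top b≤2+w₂))
    meets : ∀ j → j < k → ∃[ v ] v ∈ D × lv v ≡ 2 + j
    meets j j<k = walk-visits (conn w₁ w₂ w₁∈D w₂∈D) (2 + j)
                    (≤-trans w₁-low (m≤m+n 2 j)) (≤-trans (s≤s j<k) w₂-high)

-- Blowing up a path: ss lists the sizes of the levels 0, 1, 2, …; the
-- vertices of Fin (sum ss) are filled into the levels in order, and two
-- distinct vertices are adjacent when their levels differ by at most one.

level : (ss : List ℕ) → Fin (sum ss) → ℕ
level (s ∷ ss) i = [ (λ _ → 0) , (λ j → suc (level ss j)) ]′ (splitAt s i)

level-↑ˡ : ∀ s ss (i : Fin s) → level (s ∷ ss) (i ↑ˡ sum ss) ≡ 0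
level-↑ˡ s ss i rewrite splitAt-↑ˡ s i (sum ss) = refl

level-↑ʳ : ∀ s ss (j : Fin (sum ss)) → level (s ∷ ss) (s ↑ʳ j) ≡ suc (level ss j)
level-↑ʳ s ss j rewrite splitAt-↑ʳ s (sum ss) j = refl

level<length : ∀ ss v → level ss v < length ss
level<length (s ∷ ss) v with splitAt s v
... | inj₁ _ = s≤s z≤n
... | inj₂ j = s≤s (level<length ss j)

level-inhabited : ∀ ss → All (0 <_) ss → ∀ ℓ → ℓ < length ss → ∃[ v ] level ss v ≡ ℓ
level-inhabited (suc s ∷ ss) (_ ∷ _) zero _ = zero , refl
level-inhabited (s ∷ ss) (_ ∷ pos) (suc ℓ) (s≤s ℓ<) with level-inhabited ss pos ℓ ℓ<
... | v , v-level = s ↑ʳ v , trans (level-↑ʳ s ss v) (cong suc v-level)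

close : ℕ → ℕ → Bool
close a b = ∣ a - b ∣ ≤ᵇ 1

close-refl : ∀ ℓ → close ℓ ℓ ≡ true
close-refl zero    = refl
close-refl (suc ℓ) = close-refl ℓ

close-suc : ∀ ℓ → close ℓ (suc ℓ) ≡ true
close-suc zero    = refl
close-suc (suc ℓ) = close-suc ℓ

close⇒≤ : ∀ a b → close a b ≡ true → b ≤ suc a
close⇒≤ a b e = begin
  b                 ≤⟨ m≤∣m-n∣+n b a ⟩
  ∣ b - a ∣ + a     ≡⟨ cong (_+ a) (∣-∣-comm b a) ⟩
  ∣ a - b ∣ + a     ≤⟨ +-monoˡ-≤ a (≤ᵇ⇒≤ ∣ a - b ∣ 1 (≡true⇒T e)) ⟩
  suc a             ∎
  where open ≤-Reasoning

-- Boolean disequality, to keep the blow-up loopless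
distinct : ∀ {n} → Fin n → Fin n → Bool
distinct u v = not (does (u ≟ v))

distinct-sym : ∀ {n} (u v : Fin n) → distinct u v ≡ distinct v u
distinct-sym u v with u ≟ v | v ≟ u
... | yes _    | yes _    = refl
... | no  _    | no  _    = refl
... | yes refl | no  v≢u  = ⊥-elim (v≢u refl)
... | no  u≢v  | yes refl = ⊥-elim (u≢v refl)

distinct-irrefl : ∀ {n} (v : Fin n) → distinct v v ≡ false
distinct-irrefl v with v ≟ v
... | yes _   = refl
... | no  v≢v = ⊥-elim (v≢v refl)

blowUp : (ss : List ℕ) → Graph (sum ss)
blowUp ss = record
  { adj    = λ u v → distinct u v ∧ close (level ss u) (level ss v)
  ; sym    = λ u v → cong₂ _∧_ (distinct-sym u v) (cong (_≤ᵇ 1) (∣-∣-comm (level ss u) (level ss v)))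
  ; irrefl = λ v → cong (_∧ close (level ss v) (level ss v)) (distinct-irrefl v)
  }

weight : List ℕ → (ℕ → Bool) → ℕ
weight []       f = 0
weight (s ∷ ss) f = (if f 0 then s else 0) + weight ss (λ ℓ → f (suc ℓ))

∣tabulate∣-split : ∀ s {m} (g : Fin (s + m) → Bool) →
  ∣ tabulate g ∣ ≡ ∣ tabulate (λ i → g (i ↑ˡ m)) ∣ + ∣ tabulate (λ j → g (s ↑ʳ j)) ∣
∣tabulate∣-split zero    g = refl
∣tabulate∣-split (suc s) g with g zero
... | true  = cong suc (∣tabulate∣-split s (λ i → g (suc i)))
... | false = ∣tabulate∣-split s (λ i → g (suc i))

∣tabulate-const∣ : ∀ s b → ∣ tabulate {s} (λ _ → b) ∣ ≡ (if b then s else 0)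
∣tabulate-const∣ zero    true  = refl
∣tabulate-const∣ zero    false = refl
∣tabulate-const∣ (suc s) true  = cong suc (∣tabulate-const∣ s true)
∣tabulate-const∣ (suc s) false = ∣tabulate-const∣ s false

count-by-level : ∀ ss (f : ℕ → Bool) → ∣ tabulate (λ v → f (level ss v)) ∣ ≡ weight ss f
count-by-level []       f = refl
count-by-level (s ∷ ss) f = begin
  ∣ tabulate (λ v → f (level (s ∷ ss) v)) ∣
    ≡⟨ ∣tabulate∣-split s (λ v → f (level (s ∷ ss) v)) ⟩
  ∣ tabulate (λ i → f (level (s ∷ ss) (i ↑ˡ sum ss))) ∣ + ∣ tabulate (λ j → f (level (s ∷ ss) (s ↑ʳ j))) ∣
    ≡⟨ cong₂ _+_ (cong ∣_∣ (tabulate-cong (λ i → cong f (level-↑ˡ s ss i))))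
                 (cong ∣_∣ (tabulate-cong (λ j → cong f (level-↑ʳ s ss j)))) ⟩
  ∣ tabulate {s} (λ _ → f 0) ∣ + ∣ tabulate (λ j → f (suc (level ss j))) ∣
    ≡⟨ cong₂ _+_ (∣tabulate-const∣ s (f 0)) (count-by-level ss (λ ℓ → f (suc ℓ))) ⟩
  (if f 0 then s else 0) + weight ss (λ ℓ → f (suc ℓ))
    ∎
  where open ≡-Reasoning

module BlowUp (ss : List ℕ) where

  G : Graph (sum ss)
  G = blowUp ss

  lv : Fin (sum ss) → ℕ
  lv = level ss

  open WalkFacts G
  open Distance G

  adjacent : ∀ u v → u ≢ v → close (lv u) (lv v) ≡ true → adj G u v ≡ true
  adjacent u v u≢v e with u ≟ v
  ... | yes u≡v = ⊥-elim (u≢v u≡v)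
  ... | no  _   = e

  lipschitz : ∀ u v → adj G u v ≡ true → lv v ≤ suc (lv u)
  lipschitz u v e = close⇒≤ (lv u) (lv v) (∧-elimʳ (distinct u v) e)

  closedNbhd-levels : ∀ v → closedNbhd G v ≡ tabulate (λ u → close (lv v) (lv u))
  closedNbhd-levels v = ⊆-antisym into onto
    where
    into : closedNbhd G v ⊆ tabulate (λ u → close (lv v) (lv u))
    into {u} u∈ with x∈p∪q⁻ ⁅ v ⁆ (nbhd G v) u∈
    ... | inj₁ u∈v rewrite x∈⁅y⁆⇒x≡y v u∈v = ∈-tabulate⁺ _ (close-refl (lv v))
    ... | inj₂ u∈N = ∈-tabulate⁺ _ (∧-elimʳ (distinct v u) (∈-tabulate⁻ (adj G v) u∈N))
    onto : tabulate (λ u → close (lv v) (lv u)) ⊆ closedNbhd G v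
    onto {u} u∈ with v ≟ u
    ... | yes refl = x∈p∪q⁺ (inj₁ (x∈⁅x⁆ v))
    ... | no  v≢u  = x∈p∪q⁺ (inj₂ (∈-tabulate⁺ (adj G v) (adjacent v u v≢u (∈-tabulate⁻ _ u∈))))

  degree : ∀ v → suc (deg G v) ≡ weight ss (close (lv v))
  degree v = begin
    suc (deg G v)                               ≡⟨ ∣closedNbhd∣ v ⟨
    ∣ closedNbhd G v ∣                          ≡⟨ cong ∣_∣ (closedNbhd-levels v) ⟩
    ∣ tabulate (λ u → close (lv v) (lv u)) ∣    ≡⟨ count-by-level ss (close (lv v)) ⟩
    weight ss (close (lv v))                    ∎
    where open ≡-Reasoning

  climb : All (0 <_) ss → ∀ r → lv r ≡ 0 → ∀ ℓ v → lv v ≡ ℓ → Walk G full r v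
  climb pos r r-bottom zero v v-bottom with r ≟ v
  ... | yes refl = here ∈full
  ... | no  r≢v  = step ∈full (adjacent r v r≢v close-rv) (here ∈full)
    where
    close-rv : close (lv r) (lv v) ≡ true
    close-rv rewrite r-bottom | v-bottom = refl
  climb pos r r-bottom (suc ℓ) v v-level
    with level-inhabited ss pos ℓ (<-trans (n<1+n ℓ) (subst (_< length ss) v-level (level<length ss v)))
  ... | u , u-level =
    climb pos r r-bottom ℓ u u-level ++ʷ step ∈full (adjacent u v u≢v close-uv) (here ∈full)
    where
    u≢v : u ≢ v
    u≢v u≡v = 1+n≢n (trans (sym v-level) (trans (cong lv (sym u≡v)) u-level))
    close-uv : close (lv u) (lv v) ≡ true
    close-uv rewrite u-level | v-level = close-suc ℓ

  connected : All (0 <_) ss → Connected G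
  connected pos u v _ _ with level-inhabited ss pos 0 (≤-trans (s≤s z≤n) (level<length ss u))
  ... | r , r-bottom =
    reverse (climb pos r r-bottom (lv u) u refl) ++ʷ climb pos r r-bottom (lv v) v refl

weight-false : ∀ ss → weight ss (λ _ → false) ≡ 0
weight-false []       = refl
weight-false (s ∷ ss) = weight-false ss

window : ∀ a b c ss → a + (b + c) ≤ weight (a ∷ b ∷ c ∷ ss) (close 1)
window a b c ss = +-monoʳ-≤ a (+-monoʳ-≤ b (m≤m+n c _))

-- The extremal graphs for δ = e + 2: the blow-up of a path with level sizes
-- 1, δ, 1, (1, e+1, 1)ᵐ, 1, δ, 1.  Every vertex has degree at least δ, the
-- first one exactly δ, and there are 3m + 6 levels on 2 + (m + 2)(δ + 1)
-- vertices.
module Family (e : ℕ) where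

  δ : ℕ
  δ = suc (suc e)

  middle : ℕ → List ℕ
  middle zero    = 1 ∷ δ ∷ 1 ∷ []
  middle (suc m) = 1 ∷ suc e ∷ 1 ∷ middle m

  sizes : ℕ → List ℕ
  sizes m = 1 ∷ δ ∷ 1 ∷ middle m

  positive : ∀ m → All (0 <_) (sizes m)
  positive m = s≤s z≤n ∷ s≤s z≤n ∷ s≤s z≤n ∷ middle-positive m
    where
    middle-positive : ∀ m → All (0 <_) (middle m)
    middle-positive zero    = s≤s z≤n ∷ s≤s z≤n ∷ s≤s z≤n ∷ []
    middle-positive (suc m) = s≤s z≤n ∷ s≤s z≤n ∷ s≤s z≤n ∷ middle-positive m

  length-middle : ∀ m → length (middle m) ≡ 3 + m * 3
  length-middle zero    = refl
  length-middle (suc m) = cong (3 +_) (length-middle m)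

  sum-middle : ∀ m → sum (middle m) ≡ m * (δ + 1) + (δ + 2)
  sum-middle zero    = solve 1 (λ e → con 1 :+ ((con 2 :+ e) :+ (con 1 :+ con 0))
                                    := con 0 :+ ((con 2 :+ e) :+ con 2)) refl e
    where open +-*-Solver
  sum-middle (suc m) rewrite sum-middle m =
    solve 2 (λ e m → con 1 :+ ((con 1 :+ e) :+ (con 1 :+ (m :* ((con 2 :+ e) :+ con 1) :+ ((con 2 :+ e) :+ con 2))))
                     := ((con 1 :+ m) :* ((con 2 :+ e) :+ con 1)) :+ ((con 2 :+ e) :+ con 2)) refl e m
    where open +-*-Solver

  sum-sizes : ∀ m → sum (sizes m) ≡ 2 + (2 + m) * (δ + 1)
  sum-sizes m rewrite sum-middle m =
    solve 2 (λ e m → con 1 :+ ((con 2 :+ e) :+ (con 1 :+ (m :* ((con 2 :+ e) :+ con 1) :+ ((con 2 :+ e) :+ con 2))))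
                     := con 2 :+ (con 2 :+ m) :* ((con 2 :+ e) :+ con 1)) refl e m
    where open +-*-Solver

  wide-middle : ∀ m k → k < length (middle m) → suc δ ≤ weight (1 ∷ middle m) (close (suc k))
  wide-middle zero    0 _ = ≤-trans (n≤1+n _) (window 1 1 δ (1 ∷ []))
  wide-middle zero    1 _ = ≤-trans (s≤s (m≤m+n δ 1)) (window 1 δ 1 [])
  wide-middle zero    2 _ = ≤-reflexive (+-comm 1 δ)
  wide-middle zero    (suc (suc (suc k))) (s≤s (s≤s (s≤s ())))
  wide-middle (suc m) 0 _ = window 1 1 (suc e) (1 ∷ middle m)
  wide-middle (suc m) 1 _ =
    ≤-trans (s≤s (s≤s (≤-reflexive (+-comm 1 e)))) (window 1 (suc e) 1 (middle m))
  wide-middle (suc zero)    2 _ =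
    ≤-trans (≤-reflexive (cong suc (+-comm 2 e))) (window (suc e) 1 1 (δ ∷ 1 ∷ []))
  wide-middle (suc (suc m)) 2 _ =
    ≤-trans (≤-reflexive (cong suc (+-comm 2 e))) (window (suc e) 1 1 (suc e ∷ 1 ∷ middle m))
  wide-middle (suc m) (suc (suc (suc k))) (s≤s (s≤s (s≤s k<))) = wide-middle m k k<

  -- hence every vertex of the blow-up of `sizes m` has degree at least δ
  wide : ∀ m ℓ → ℓ < length (sizes m) → suc δ ≤ weight (sizes m) (close ℓ)
  wide m 0 _ = s≤s (m≤m+n δ _)
  wide m 1 _ = s≤s (m≤m+n δ _)
  wide m 2 _ = m<m+n δ (s≤s z≤n)
  wide m (suc (suc (suc k))) (s≤s (s≤s (s≤s k<))) = wide-middle m k k<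

  module Member (m : ℕ) where
    open BlowUp (sizes m)

    n : ℕ
    n = sum (sizes m)

    bottom : Fin n
    bottom = zero

    top : ∃[ v ] lv v ≡ 3 + (2 + m * 3)
    top = level-inhabited (sizes m) (positive m) (3 + (2 + m * 3)) top<length
      where
      top<length : 3 + (2 + m * 3) < length (sizes m)
      top<length rewrite length-middle m = ≤-refl

    min-degree : IsMinDegree G δ
    min-degree = (λ v → s≤s⁻¹ (subst (suc δ ≤_) (sym (degree v))
                                 (wide m (lv v) (level<length (sizes m) v)))) ,
                 bottom , suc-injective (trans (degree bottom) exact)
      where
      exact : weight (sizes m) (close 0) ≡ suc δ
      exact = cong suc (trans (cong (δ +_) (weight-false (1 ∷ middle m))) (+-identityʳ δ))

    -- every connected two-step dominating set meets the 3m + 2 levels 2, …, 3m + 3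
    lower-bound : ∀ D → ConnTwoStepDom G D → 3 * (n ∸ 2) ≤ (∣ D ∣ + 4) * (δ + 1)
    lower-bound D D-cds = begin
      3 * (n ∸ 2)                   ≡⟨ cong (λ k → 3 * (k ∸ 2)) (sum-sizes m) ⟩
      3 * ((2 + m) * (δ + 1))       ≡⟨ solve 2 (λ m d → con 3 :* ((con 2 :+ m) :* d)
                                                 := (con 2 :+ m :* con 3 :+ con 4) :* d) refl m (δ + 1) ⟩
      (2 + m * 3 + 4) * (δ + 1)     ≤⟨ *-monoˡ-≤ (δ + 1) (+-monoˡ-≤ 4 levels) ⟩
      (∣ D ∣ + 4) * (δ + 1)         ∎
      where
      open ≤-Reasoning
      open +-*-Solver
      open Levelled G lv lipschitz
      levels : 2 + m * 3 ≤ ∣ D ∣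
      levels = spanning-lower-bound (2 + m * 3) bottom (proj₁ top) refl (proj₂ top) D-cds

    large : m ≤ n
    large = begin
      m                         ≤⟨ m≤m*n m (δ + 1) ⟩
      m * (δ + 1)               ≤⟨ *-monoˡ-≤ (δ + 1) (m≤n+m m 2) ⟩
      (2 + m) * (δ + 1)         ≤⟨ m≤n+m _ 2 ⟩
      2 + (2 + m) * (δ + 1)     ≡⟨ sum-sizes m ⟨
      n                         ∎
      where open ≤-Reasoning

sharpness : (δ : ℕ) → 2 ≤ δ → (m : ℕ) →
  Σ ℕ λ n → m ≤ n × Σ (Graph n) λ G → Connected G × IsMinDegree G δ
    × ((D : Subset n) → ConnTwoStepDom G D → 3 * (n ∸ 2) ≤ (∣ D ∣ + 4) * (δ + 1))
sharpness (suc (suc e)) (s≤s (s≤s z≤n)) m =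
  n , large , G , connected (positive m) , min-degree , lower-bound
  where
  open Family e
  open Member m
  open BlowUp (sizes m)

theorem6 :
    ((n : ℕ) (G : Graph n) (δ : ℕ) → Connected G → IsMinDegree G δ →
      Σ (Subset n) λ D → ConnTwoStepDom G D
        × (∣ D ∣ + 2) * (δ + 1) ≤ 3 * (n ∸ ∣ N G 2 D ∣))
    × ((n : ℕ) (G : Graph n) (δ : ℕ) → 4 ≤ n → Connected G → IsMinDegree G δ →
      Σ (Subset n) λ D' → ConnTwoWayTwoStepDom G D'
        × (∣ D' ∣ + 2) * (δ + 1) ≤ 3 * n)
    × ((δ : ℕ) → 2 ≤ δ → (m : ℕ) →
      Σ ℕ λ n → m ≤ n × Σ (Graph n) λ G → Connected G × IsMinDegree G δ
        × ((D : Subset n) → ConnTwoStepDom G D →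
            3 * (n ∸ 2) ≤ (∣ D ∣ + 4) * (δ + 1)))
theorem6 = connected-two-step-domination , connected-two-way-two-step-domination , sharpness
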